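{- Let $n$ be a positive integer and $m=\lfloor (n-1)/2\rfloor$. Then the polynomials $R_n^{D}(t)$, $R_n^{B-D}(t)$, $R_n^{D,+}(t)$, $R_n^{D,- }(t)$, $R_n^{B-D,+}(t)$ and $R_n^{B-D,- }(t)$ are all divisible by $(1+t)^m$.
   Context: $\mathfrak{B}_n$ is the group of signed permutations in window notation $\pi=\pi_1\cdots\pi_n$, and $\mathfrak{D}_n$ the subset with an even number of negative entries. For $\pi\in\mathfrak{B}_n$, $\mathrm{inv}_D(\pi)=|\{i<j:\pi_i>\pi_j\}|+|\{i<j:-\pi_i>\pi_j\}|$. Let $\mathfrak{D}_n^+=\{\pi\in\mathfrak{D}_n:\mathrm{inv}_D(\pi)\text{ even}\}$, $\mathfrak{D}_n^-=\mathfrak{D}_n\setminus\mathfrak{D}_n^+$, $(\mathfrak{B}_n\setminus\mathfrak{D}_n)^+=\{\pi\in\mathfrak{B}_n\setminus\mathfrak{D}_n:\mathrm{inv}_D(\pi)\text{ even}\}$ and $(\mathfrak{B}_n\setminus\mathfrak{D}_n)^-$ its complement in $\mathfrak{B}_n\setminus\mathfrak{D}_n$. Set $\pi_0=0$; $\mathrm{pk}_D(\pi)$ (resp. $\mathrm{val}_D(\pi)$) is the number of $i\in\{1,\dots,n-1\}$ with $\pi_{i-1}<\pi_i>\pi_{i+1}$ (resp. $\pi_{i-1}>\pi_i<\pi_{i+1}$), and $\mathrm{altruns}_D(\pi)=\mathrm{pk}_D(\pi)+\mathrm{val}_D(\pi)+1$. Define $R_n^D,R_n^{B-D},R_n^{D,\pm},R_n^{B-D,\pm}$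 as $\sum t^{\mathrm{altruns}_D(\pi)}$ over $\mathfrak{D}_n$, $\mathfrak{B}_n\setminus\mathfrak{D}_n$, $\mathfrak{D}_n^{\pm}$, $(\mathfrak{B}_n\setminus\mathfrak{D}_n)^{\pm}$ respectively. -}

module Defs where

open import Data.Bool using (Bool; true; false; not; _∧_; _∨_; if_then_else_)
open import Data.Nat as ℕ using (ℕ; zero; suc)
open import Data.Nat.DivMod using (_%_)
open import Data.Integer as ℤ using (ℤ; +_; -[1+_]; -_; ∣_∣)
open import Data.List using (List; []; _∷_; map; filter; concatMap; upTo; length; foldr; _++_)
open import Relation.Nullary.Decidable using (⌊_⌋)
open import Data.Bool.Properties using () renaming (_≟_ to _≟B_)
open import Relation.Binary.PropositionalEquality using (_≡_)
open import Data.Product using (∃)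

-- Signed permutations in window notation: a word π₁⋯πₙ of nonzero
-- integers in {±1,…,±n} whose absolute values are pairwise distinct.

letters : ℕ → List ℤ
letters n = map (λ k → + suc k) (upTo n) ++ map -[1+_] (upTo n)

words : List ℤ → ℕ → List (List ℤ)
words A zero    = [] ∷ []
words A (suc k) = concatMap (λ w → map (_∷ w) A) (words A k)

absMem : ℤ → List ℤ → Bool
absMem x []       = false
absMem x (y ∷ ys) = ⌊ ∣ x ∣ ℕ.≟ ∣ y ∣ ⌋ ∨ absMem x ys

absDistinct : List ℤ → Bool
absDistinct []       = true
absDistinct (x ∷ xs) = not (absMem x xs) ∧ absDistinct xs

B : ℕ → List (List ℤ)
B n = filter (λ w → absDistinct w ≟B true) (words (letters n) n)

countB : Bool → ℕ
countB true  = 1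
countB false = 0

lt : ℤ → ℤ → Bool
lt x y = ⌊ x ℤ.<? y ⌋

neg : List ℤ → ℕ
neg []       = 0
neg (x ∷ xs) = countB (lt x (+ 0)) ℕ.+ neg xs

isEven : ℕ → Bool
isEven k = ⌊ k % 2 ℕ.≟ 0 ⌋

inD : List ℤ → Bool
inD π = isEven (neg π)

invFrom : ℤ → List ℤ → ℕ
invFrom x []       = 0
invFrom x (y ∷ ys) = countB (lt y x) ℕ.+ countB (lt y (- x)) ℕ.+ invFrom x ys

invD : List ℤ → ℕ
invD []       = 0
invD (x ∷ xs) = invFrom x xs ℕ.+ invD xs

-- peaks/valleys of the word π₀π₁⋯πₙ with π₀ = 0, at positions i = 1,…,n-1,
-- i.e. at every interior position of the list 0 ∷ π.
pkL : List ℤ → ℕ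
pkL (a ∷ b ∷ c ∷ rest) = countB (lt a b ∧ lt c b) ℕ.+ pkL (b ∷ c ∷ rest)
pkL _ = 0

valL : List ℤ → ℕ
valL (a ∷ b ∷ c ∷ rest) = countB (lt b a ∧ lt b c) ℕ.+ valL (b ∷ c ∷ rest)
valL _ = 0

pkD : List ℤ → ℕ
pkD π = pkL (+ 0 ∷ π)

valD : List ℤ → ℕ
valD π = valL (+ 0 ∷ π)

altrunsD : List ℤ → ℕ
altrunsD π = pkD π ℕ.+ valD π ℕ.+ 1

-- Polynomials in t with integer coefficients, as coefficient lists
-- (constant term first; trailing zeros allowed).

Poly : Set
Poly = List ℤ

coeff : Poly → ℕ → ℤ
coeff []       _       = + 0
coeff (a ∷ p)  zero    = a
coeff (a ∷ p)  (suc k) = coeff p k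

_≈P_ : Poly → Poly → Set
p ≈P q = ∀ k → coeff p k ≡ coeff q k

_+P_ : Poly → Poly → Poly
[]      +P q       = q
p       +P []      = p
(a ∷ p) +P (b ∷ q) = (a ℤ.+ b) ∷ (p +P q)

scale : ℤ → Poly → Poly
scale c = map (c ℤ.*_)

_*P_ : Poly → Poly → Poly
[]      *P q = []
(a ∷ p) *P q = scale a q +P (+ 0 ∷ (p *P q))

_^P_ : Poly → ℕ → Poly
p ^P zero  = + 1 ∷ []
p ^P suc k = p *P (p ^P k)

tPow : ℕ → Poly
tPow zero    = + 1 ∷ []
tPow (suc k) = + 0 ∷ tPow k

onePlusT : Poly
onePlusT = + 1 ∷ + 1 ∷ []

_∣P_ : Poly → Poly → Set
d ∣P p = ∃ λ q → p ≈P (d *P q)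

genAlt : List (List ℤ) → Poly
genAlt S = foldr (λ π acc → tPow (altrunsD π) +P acc) [] S

sel : (List ℤ → Bool) → ℕ → List (List ℤ)
sel P n = filter (λ π → P π ≟B true) (B n)

R-D : ℕ → Poly
R-D n = genAlt (sel inD n)

R-BD : ℕ → Poly
R-BD n = genAlt (sel (λ π → not (inD π)) n)

R-D+ : ℕ → Poly
R-D+ n = genAlt (sel (λ π → inD π ∧ isEven (invD π)) n)

R-D- : ℕ → Poly
R-D- n = genAlt (sel (λ π → inD π ∧ not (isEven (invD π))) n)

R-BD+ : ℕ → Poly
R-BD+ n = genAlt (sel (λ π → not (inD π) ∧ isEven (invD π)) n)

R-BD- : ℕ → Poly
R-BD- n = genAlt (sel (λ π → not (inD π) ∧ not (isEven (invD π))) n)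

-- Flip the signs of the last 2k + 2 entries of a signed permutation π, for k = 0, …, m - 1.  With
-- π₀ = 0 prepended, altruns_D(π) is one more than the number of turns (peaks and valleys), and
-- each such flip toggles exactly one turn, at a position that depends only on ∣π∣; for distinct k
-- these positions are distinct.  The flips change an even number of signs and no absolute value,
-- so they preserve membership in 𝔇ₙ and the parity of inv_D, which has the parity of the
-- inversion number of ∣π∣.  Hence they generate a free action of (ℤ/2)^m on each of the six sets,
-- and summing over an orbit, whose turn counts are r, r+1, …, r+m with binomial multiplicities,
-- gives a multiple of (1+t)^m.
module Submission where

open import Data.Bool using (Bool; true; false; not; _∧_; _∨_; _xor_; if_then_else_)
open import Data.Bool.Properties
  using (not-involutive; not-distribˡ-xor; not-distribʳ-xor; xor-annihilates-not;
         ∧-identityʳ; ∧-zeroʳ; ∧-comm)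
  renaming (_≟_ to _≟B_)
open import Data.Empty using (⊥-elim)
open import Data.Integer as ℤ using (ℤ; +_; -[1+_]; -_; ∣_∣)
import Data.Integer.Properties as ℤ
open import Data.Integer.Tactic.RingSolver using (solve-∀)
open import Data.List using (List; []; _∷_; map; length; foldr; filter; upTo)
open import Data.List.Membership.Propositional using (_∈_; find; lose)
open import Data.List.Membership.Propositional.Properties
  using (∈-map⁺; ∈-map⁻; ∈-++⁺ˡ; ∈-++⁺ʳ; ∈-++⁻; ∈-concatMap⁺; ∈-concatMap⁻; ∈-filter⁺; ∈-filter⁻)
open import Data.List.Membership.Propositional.Properties.WithK using (unique∧set⇒bag)
open import Data.List.Properties using (∷-injective; length-map)
open import Data.List.Relation.Binary.BagAndSetEquality using (∼bag⇒↭)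
open import Data.List.Relation.Binary.Disjoint.Propositional using (Disjoint)
open import Data.List.Relation.Binary.Permutation.Propositional as ↭ using (_↭_)
open import Data.List.Relation.Unary.All as All using (All; []; _∷_)
import Data.List.Relation.Unary.All.Properties as All
open import Data.List.Relation.Unary.AllPairs as AllPairs using (AllPairs; []; _∷_)
import Data.List.Relation.Unary.AllPairs.Properties as AllPairs
open import Data.List.Relation.Unary.Any using (here; there)
open import Data.List.Relation.Unary.Linked as Linked using (Linked; []; [-]; _∷_)
open import Data.List.Relation.Unary.Linked.Properties using (AllPairs⇒Linked)
open import Data.List.Relation.Unary.Unique.Propositional using (Unique)
import Data.List.Relation.Unary.Unique.Propositional.Properties as Unique
open import Data.Nat using (ℕ; zero; suc; _+_; _*_; _<_; _≤_; _∸_; _/_; _<ᵇ_; _≡ᵇ_; z≤n; s≤s)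
open import Data.Nat.DivMod using (m/n*n≤m)
import Data.Nat.Properties as ℕ
open import Algebra.Properties.CommutativeSemigroup ℕ.+-commutativeSemigroup
  using (interchange; x∙yz≈y∙xz)
open import Data.Nat.Tactic.RingSolver using () renaming (solve-∀ to solve-∀-ℕ)
open import Data.Product using (_×_; _,_; proj₁; proj₂)
open import Data.Sum using (inj₁; inj₂)
open import Defs
open import Function using (_∘_; id; _⟨_⟩_)
open import Function.Bundles using (mk⇔)
open import Relation.Binary.Definitions using (tri<; tri≈; tri>)
open import Relation.Binary.PropositionalEquality
open import Relation.Nullary using (¬_; yes; no)
open import Relation.Nullary.Decidable using (⌊_⌋; isYes≗does; dec-true; dec-false)

module _ {A : Set} where

  count : (A → Bool) → List A → ℕ
  count f []      = 0
  count f (x ∷ L) = countB (f x) + count f L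

  count-cong : ∀ {f g : A → Bool} L → (∀ {x} → x ∈ L → f x ≡ g x) → count f L ≡ count g L
  count-cong []      f≗g = refl
  count-cong (x ∷ L) f≗g = cong₂ _+_ (cong countB (f≗g (here refl))) (count-cong L (f≗g ∘ there))

  count-split : ∀ (f g : A → Bool) L →
    count f L ≡ count (λ x → f x ∧ not (g x)) L + count (λ x → f x ∧ g x) L
  count-split f g []      = refl
  count-split f g (x ∷ L) with f x | g x
  ... | false | _     = count-split f g L
  ... | true  | false = cong suc (count-split f g L)
  ... | true  | true  = trans (cong suc (count-split f g L)) (sym (ℕ.+-suc _ _))

  count-↭ : ∀ (f : A → Bool) {L M} → L ↭ M → count f L ≡ count f M
  count-↭ f ↭.refl         = refl
  count-↭ f (↭.prep x p)   = cong (_+_ (countB (f x))) (count-↭ f p)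
  count-↭ f (↭.swap x y p) = trans (x∙yz≈y∙xz (countB (f x)) (countB (f y)) _)
                                   (cong (λ n → countB (f y) + (countB (f x) + n)) (count-↭ f p))
  count-↭ f (↭.trans p q)  = trans (count-↭ f p) (count-↭ f q)

  count-map : ∀ (f : A → Bool) (h : A → A) L → count f (map h L) ≡ count (f ∘ h) L
  count-map f h []      = refl
  count-map f h (x ∷ L) = cong (_+_ (countB (f (h x)))) (count-map f h L)

  map-involution-↭ : ∀ {h : A → A} {S} → Unique S → (∀ x → h (h x) ≡ x) →
    (∀ {x} → x ∈ S → h x ∈ S) → map h S ↭ S
  map-involution-↭ {h} {S} uniq invol closed =
    ∼bag⇒↭ (unique∧set⇒bag (Unique.map⁺ injective uniq) uniq (mk⇔ to from))
    where
    injective : ∀ {x y} → h x ≡ h y → x ≡ y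
    injective {x} {y} hx≡hy = trans (sym (invol x)) (trans (cong h hx≡hy) (invol y))
    to : ∀ {x} → x ∈ map h S → x ∈ S
    to x∈hS with ∈-map⁻ h x∈hS
    ... | y , y∈S , refl = closed y∈S
    from : ∀ {x} → x ∈ S → x ∈ map h S
    from {x} x∈S = subst (_∈ map h S) (invol x) (∈-map⁺ h (closed x∈S))

  count-involution : ∀ (f : A → Bool) {h : A → A} {S} → Unique S → (∀ x → h (h x) ≡ x) →
    (∀ {x} → x ∈ S → h x ∈ S) → count f S ≡ count (f ∘ h) S
  count-involution f {h} {S} uniq invol closed =
    trans (sym (count-↭ f (map-involution-↭ uniq invol closed))) (count-map f h S)

-- Parity by structural recursion, so that even (suc k) reduces to not (even k).
even : ℕ → Bool
even zero    = true
even (suc k) = not (even k)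

isEven≡even : ∀ k → isEven k ≡ even k
isEven≡even zero          = refl
isEven≡even (suc zero)    = refl
isEven≡even (suc (suc k)) = trans (isEven≡even k) (sym (not-involutive (even k)))

even-+ : ∀ a b → even (a + b) ≡ not (even a xor even b)
even-+ zero    b = sym (not-involutive (even b))
even-+ (suc a) b = cong not (trans (even-+ a b) (not-distribˡ-xor (even a) (even b)))

even-cong-+ : ∀ a a′ b b′ → even a ≡ even a′ → even b ≡ even b′ → even (a + b) ≡ even (a′ + b′)
even-cong-+ a a′ b b′ ea eb =
  trans (even-+ a b) (trans (cong₂ (λ x y → not (x xor y)) ea eb) (sym (even-+ a′ b′)))

even-+-true : ∀ a b → even (a + b) ≡ true → even a ≡ even b
even-+-true a b a+b-even rewrite even-+ a b with even a | even b
... | true  | true  = refl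
... | false | false = refl

even-double : ∀ k → even (k + k) ≡ true
even-double zero    = refl
even-double (suc k) rewrite ℕ.+-suc k k | not-involutive (even (k + k)) = even-double k

coeff-+P : ∀ p q k → coeff (p +P q) k ≡ coeff p k ℤ.+ coeff q k
coeff-+P []      q       k       = sym (ℤ.+-identityˡ (coeff q k))
coeff-+P (a ∷ p) []      k       = sym (ℤ.+-identityʳ (coeff (a ∷ p) k))
coeff-+P (a ∷ p) (b ∷ q) zero    = refl
coeff-+P (a ∷ p) (b ∷ q) (suc k) = coeff-+P p q k

coeff-scale : ∀ a p k → coeff (scale a p) k ≡ a ℤ.* coeff p k
coeff-scale a []      k       = sym (ℤ.*-zeroʳ a)
coeff-scale a (b ∷ p) zero    = refl
coeff-scale a (b ∷ p) (suc k) = coeff-scale a p k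

coeff-∷*P : ∀ a p q k → coeff ((a ∷ p) *P q) k ≡ a ℤ.* coeff q k ℤ.+ coeff (+ 0 ∷ (p *P q)) k
coeff-∷*P a p q k =
  trans (coeff-+P (scale a q) (+ 0 ∷ (p *P q)) k) (cong (ℤ._+ _) (coeff-scale a q k))

∷-cong : ∀ {a p q} → p ≈P q → (a ∷ p) ≈P (a ∷ q)
∷-cong p≈q zero    = refl
∷-cong p≈q (suc k) = p≈q k

*P-congʳ : ∀ p {q q′} → q ≈P q′ → (p *P q) ≈P (p *P q′)
*P-congʳ []      q≈q′ k = refl
*P-congʳ (a ∷ p) {q} {q′} q≈q′ k = begin
  coeff ((a ∷ p) *P q) k                                ≡⟨ coeff-∷*P a p q k ⟩
  a ℤ.* coeff q k ℤ.+ coeff (+ 0 ∷ (p *P q)) k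
    ≡⟨ cong₂ ℤ._+_ (cong (a ℤ.*_) (q≈q′ k)) (∷-cong (*P-congʳ p q≈q′) k) ⟩
  a ℤ.* coeff q′ k ℤ.+ coeff (+ 0 ∷ (p *P q′)) k        ≡⟨ coeff-∷*P a p q′ k ⟨
  coeff ((a ∷ p) *P q′) k                               ∎
  where open ≡-Reasoning

coeff-+P-*P : ∀ p r q k → coeff ((p +P r) *P q) k ≡ coeff (p *P q) k ℤ.+ coeff (r *P q) k
coeff-+P-*P []      r       q k = sym (ℤ.+-identityˡ _)
coeff-+P-*P (a ∷ p) []      q k = sym (ℤ.+-identityʳ _)
coeff-+P-*P (a ∷ p) (b ∷ r) q k = begin
  coeff ((a ℤ.+ b ∷ (p +P r)) *P q) k
    ≡⟨ coeff-∷*P (a ℤ.+ b) (p +P r) q k ⟩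
  (a ℤ.+ b) ℤ.* coeff q k ℤ.+ coeff (+ 0 ∷ ((p +P r) *P q)) k
    ≡⟨ cong (ℤ._+_ ((a ℤ.+ b) ℤ.* coeff q k)) (shifted k) ⟩
  (a ℤ.+ b) ℤ.* coeff q k ℤ.+ (coeff (+ 0 ∷ (p *P q)) k ℤ.+ coeff (+ 0 ∷ (r *P q)) k)
    ≡⟨ interchange-distrib a b (coeff q k) _ _ ⟩
  (a ℤ.* coeff q k ℤ.+ coeff (+ 0 ∷ (p *P q)) k) ℤ.+ (b ℤ.* coeff q k ℤ.+ coeff (+ 0 ∷ (r *P q)) k)
    ≡⟨ cong₂ ℤ._+_ (coeff-∷*P a p q k) (coeff-∷*P b r q k) ⟨
  coeff ((a ∷ p) *P q) k ℤ.+ coeff ((b ∷ r) *P q) k ∎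
  where
  open ≡-Reasoning
  interchange-distrib : ∀ a b c x y →
    (a ℤ.+ b) ℤ.* c ℤ.+ (x ℤ.+ y) ≡ (a ℤ.* c ℤ.+ x) ℤ.+ (b ℤ.* c ℤ.+ y)
  interchange-distrib = solve-∀
  shifted : ∀ k →
    coeff (+ 0 ∷ ((p +P r) *P q)) k ≡ coeff (+ 0 ∷ (p *P q)) k ℤ.+ coeff (+ 0 ∷ (r *P q)) k
  shifted zero    = refl
  shifted (suc k) = coeff-+P-*P p r q k

scale-*P : ∀ a p q → (scale a p *P q) ≈P scale a (p *P q)
scale-*P a []      q k = refl
scale-*P a (b ∷ p) q k = begin
  coeff ((a ℤ.* b ∷ scale a p) *P q) k
    ≡⟨ coeff-∷*P (a ℤ.* b) (scale a p) q k ⟩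
  a ℤ.* b ℤ.* coeff q k ℤ.+ coeff (+ 0 ∷ (scale a p *P q)) k
    ≡⟨ cong (ℤ._+_ (a ℤ.* b ℤ.* coeff q k)) (shifted k) ⟩
  a ℤ.* b ℤ.* coeff q k ℤ.+ a ℤ.* coeff (+ 0 ∷ (p *P q)) k
    ≡⟨ assoc-distrib a b (coeff q k) _ ⟩
  a ℤ.* (b ℤ.* coeff q k ℤ.+ coeff (+ 0 ∷ (p *P q)) k)
    ≡⟨ cong (a ℤ.*_) (coeff-∷*P b p q k) ⟨
  a ℤ.* coeff ((b ∷ p) *P q) k
    ≡⟨ coeff-scale a ((b ∷ p) *P q) k ⟨
  coeff (scale a ((b ∷ p) *P q)) k ∎
  where
  open ≡-Reasoning
  assoc-distrib : ∀ a b c x → a ℤ.* b ℤ.* c ℤ.+ a ℤ.* x ≡ a ℤ.* (b ℤ.* c ℤ.+ x)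
  assoc-distrib = solve-∀
  shifted : ∀ k → coeff (+ 0 ∷ (scale a p *P q)) k ≡ a ℤ.* coeff (+ 0 ∷ (p *P q)) k
  shifted zero    = sym (ℤ.*-zeroʳ a)
  shifted (suc k) = trans (scale-*P a p q k) (coeff-scale a (p *P q) k)

shift-*P : ∀ p q → ((+ 0 ∷ p) *P q) ≈P (+ 0 ∷ (p *P q))
shift-*P p q k = trans (coeff-∷*P (+ 0) p q k) (ℤ.+-identityˡ _)

*P-assoc : ∀ p q r → ((p *P q) *P r) ≈P (p *P (q *P r))
*P-assoc []      q r k = refl
*P-assoc (a ∷ p) q r k = begin
  coeff ((scale a q +P (+ 0 ∷ (p *P q))) *P r) k
    ≡⟨ coeff-+P-*P (scale a q) (+ 0 ∷ (p *P q)) r k ⟩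
  coeff (scale a q *P r) k ℤ.+ coeff ((+ 0 ∷ (p *P q)) *P r) k
    ≡⟨ cong₂ ℤ._+_ (scale-*P a q r k) (shift-*P (p *P q) r k) ⟩
  coeff (scale a (q *P r)) k ℤ.+ coeff (+ 0 ∷ ((p *P q) *P r)) k
    ≡⟨ cong₂ ℤ._+_ (coeff-scale a (q *P r) k) (∷-cong (*P-assoc p q r) k) ⟩
  a ℤ.* coeff (q *P r) k ℤ.+ coeff (+ 0 ∷ (p *P (q *P r))) k
    ≡⟨ coeff-∷*P a p (q *P r) k ⟨
  coeff ((a ∷ p) *P (q *P r)) k ∎
  where open ≡-Reasoning

*P-identityˡ : ∀ p → ((+ 1 ∷ []) *P p) ≈P p
*P-identityˡ p k = begin
  coeff ((+ 1 ∷ []) *P p) k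
    ≡⟨ coeff-∷*P (+ 1) [] p k ⟩
  + 1 ℤ.* coeff p k ℤ.+ coeff (+ 0 ∷ []) k
    ≡⟨ cong₂ ℤ._+_ (ℤ.*-identityˡ (coeff p k)) (coeff-0∷[] k) ⟩
  coeff p k ℤ.+ + 0
    ≡⟨ ℤ.+-identityʳ (coeff p k) ⟩
  coeff p k ∎
  where
  open ≡-Reasoning
  coeff-0∷[] : ∀ k → coeff (+ 0 ∷ []) k ≡ + 0
  coeff-0∷[] zero    = refl
  coeff-0∷[] (suc k) = refl

coeff-onePlusT*P : ∀ p k → coeff (onePlusT *P p) k ≡ coeff p k ℤ.+ coeff (+ 0 ∷ p) k
coeff-onePlusT*P p k =
  trans (coeff-∷*P (+ 1) (+ 1 ∷ []) p k)
        (cong₂ ℤ._+_ (ℤ.*-identityˡ (coeff p k)) (∷-cong (*P-identityˡ p) k))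

genPoly : ∀ {A : Set} → (A → ℕ) → List A → Poly
genPoly stat = foldr (λ x acc → tPow (stat x) +P acc) []

coeff-tPow : ∀ a k → coeff (tPow a) k ≡ + countB (a ≡ᵇ k)
coeff-tPow zero    zero    = refl
coeff-tPow zero    (suc k) = refl
coeff-tPow (suc a) zero    = refl
coeff-tPow (suc a) (suc k) = coeff-tPow a k

module _ {A : Set} where

  coeff-genPoly : ∀ (stat : A → ℕ) L k → coeff (genPoly stat L) k ≡ + count (λ x → stat x ≡ᵇ k) L
  coeff-genPoly stat []      k = refl
  coeff-genPoly stat (x ∷ L) k =
    trans (coeff-+P (tPow (stat x)) (genPoly stat L) k)
          (cong₂ ℤ._+_ (coeff-tPow (stat x) k) (coeff-genPoly stat L k))

  shift-genPoly : ∀ (stat : A → ℕ) L → (+ 0 ∷ genPoly stat L) ≈P genPoly (suc ∘ stat) L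
  shift-genPoly stat L zero    =
    sym (trans (coeff-genPoly (suc ∘ stat) L zero) (cong +_ (count-false L)))
    where
    count-false : ∀ L → count (λ _ → false) L ≡ 0
    count-false []      = refl
    count-false (_ ∷ L) = count-false L
  shift-genPoly stat L (suc k) =
    trans (coeff-genPoly stat L k) (sym (coeff-genPoly (suc ∘ stat) L (suc k)))

  count-filter : ∀ (f g : A → Bool) L →
    count g (filter (λ x → f x ≟B true) L) ≡ count (λ x → f x ∧ g x) L
  count-filter f g []      = refl
  count-filter f g (x ∷ L) with f x
  ... | true  = cong (_+_ (countB (g x))) (count-filter f g L)
  ... | false = count-filter f g L

  filter-true : ∀ (L : List A) → filter (λ _ → true ≟B true) L ≡ L
  filter-true []      = refl
  filter-true (x ∷ L) = cong (x ∷_) (filter-true L)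

-- G s sums t^stat over the x ∈ S whose bits below s are all off.  Among these, φ s matches
-- each x with bit s on to one with bit s off and stat one lower, so G s = (1 + t) G (s + 1);
-- iterating from G 0 = Σ_S t^stat up to G m extracts (1 + t)^m.
module TogglingInvolutions
  {A : Set} (S : List A) (unique : Unique S) (stat : A → ℕ) (m : ℕ)
  (bit : ℕ → A → Bool) (φ : ℕ → A → A)
  (φ-involutive : ∀ {k} → k < m → ∀ x → φ k (φ k x) ≡ x)
  (φ-closed : ∀ {k x} → k < m → x ∈ S → φ k x ∈ S)
  (bit-φ : ∀ {k x} → k < m → x ∈ S → bit k (φ k x) ≡ not (bit k x))
  (bit-φ-< : ∀ {j k x} → j < k → k < m → x ∈ S → bit j (φ k x) ≡ bit j x)
  (stat-φ : ∀ {k x} → k < m → x ∈ S → bit k x ≡ false → stat (φ k x) ≡ suc (stat x))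
  where

  allOff : ℕ → A → Bool
  allOff zero    x = true
  allOff (suc s) x = allOff s x ∧ not (bit s x)

  allOff-φ : ∀ s {k x} → s ≤ k → k < m → x ∈ S → allOff s (φ k x) ≡ allOff s x
  allOff-φ zero    _         _   _   = refl
  allOff-φ (suc s) s<k k<m x∈S =
    cong₂ _∧_ (allOff-φ s (ℕ.<⇒≤ s<k) k<m x∈S) (cong not (bit-φ-< s<k k<m x∈S))

  bitsOff : ℕ → List A
  bitsOff s = filter (λ x → allOff s x ≟B true) S

  G : ℕ → Poly
  G s = genPoly stat (bitsOff s)

  coeff-bitsOff : ∀ s (f : A → ℕ) j →
    coeff (genPoly f (bitsOff s)) j ≡ + count (λ x → allOff s x ∧ (f x ≡ᵇ j)) S
  coeff-bitsOff s f j =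
    trans (coeff-genPoly f (bitsOff s) j) (cong +_ (count-filter (allOff s) (λ x → f x ≡ᵇ j) S))

  count-bitOn : ∀ {s} → s < m → ∀ j →
    count (λ x → (allOff s x ∧ (stat x ≡ᵇ j)) ∧ bit s x) S
      ≡ count (λ x → allOff (suc s) x ∧ (suc (stat x) ≡ᵇ j)) S
  count-bitOn {s} s<m j =
    trans (count-cong S paired) (sym (count-involution _ unique (φ-involutive s<m) (φ-closed s<m)))
    where
    paired : ∀ {x} → x ∈ S →
      (allOff s x ∧ (stat x ≡ᵇ j)) ∧ bit s x ≡ allOff (suc s) (φ s x) ∧ (suc (stat (φ s x)) ≡ᵇ j)
    paired {x} x∈S = trans (swap (allOff s x) (bit s x) (cong (_≡ᵇ j) ∘ stat-back))
      (cong₂ (λ a b → (a ∧ not b) ∧ (suc (stat (φ s x)) ≡ᵇ j))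
        (sym (allOff-φ s ℕ.≤-refl s<m x∈S)) (sym (bit-φ s<m x∈S)))
      where
      stat-back : bit s x ≡ true → stat x ≡ suc (stat (φ s x))
      stat-back on = trans (cong stat (sym (φ-involutive s<m x)))
        (stat-φ s<m (φ-closed s<m x∈S) (trans (bit-φ s<m x∈S) (cong not on)))
      swap : ∀ a b {e e′} → (b ≡ true → e ≡ e′) → (a ∧ e) ∧ b ≡ (a ∧ not (not b)) ∧ e′
      swap false b     _     = refl
      swap true  true  e≡e′ = trans (∧-identityʳ _) (e≡e′ refl)
      swap true  false _     = ∧-zeroʳ _

  G-step : ∀ {s} → s < m → G s ≈P (onePlusT *P G (suc s))
  G-step {s} s<m j = begin
    coeff (G s) j
      ≡⟨ coeff-bitsOff s stat j ⟩
    + count (λ x → allOff s x ∧ (stat x ≡ᵇ j)) S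
      ≡⟨ cong +_ (count-split (λ x → allOff s x ∧ (stat x ≡ᵇ j)) (bit s) S) ⟩
    + (count (λ x → (allOff s x ∧ (stat x ≡ᵇ j)) ∧ not (bit s x)) S
       + count (λ x → (allOff s x ∧ (stat x ≡ᵇ j)) ∧ bit s x) S)
      ≡⟨ cong +_ (cong₂ _+_ (count-cong S (λ _ → bit-off _)) (count-bitOn s<m j)) ⟩
    + (count (λ x → allOff (suc s) x ∧ (stat x ≡ᵇ j)) S
       + count (λ x → allOff (suc s) x ∧ (suc (stat x) ≡ᵇ j)) S)
      ≡⟨ cong₂ ℤ._+_ (coeff-bitsOff (suc s) stat j) (coeff-bitsOff (suc s) (suc ∘ stat) j) ⟨
    coeff (G (suc s)) j ℤ.+ coeff (genPoly (suc ∘ stat) (bitsOff (suc s))) j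
      ≡⟨ cong (ℤ._+_ (coeff (G (suc s)) j)) (shift-genPoly stat (bitsOff (suc s)) j) ⟨
    coeff (G (suc s)) j ℤ.+ coeff (+ 0 ∷ G (suc s)) j
      ≡⟨ coeff-onePlusT*P (G (suc s)) j ⟨
    coeff (onePlusT *P G (suc s)) j ∎
    where
    open ≡-Reasoning
    bit-off : ∀ x → (allOff s x ∧ (stat x ≡ᵇ j)) ∧ not (bit s x) ≡ allOff (suc s) x ∧ (stat x ≡ᵇ j)
    bit-off x = swap (allOff s x) (stat x ≡ᵇ j) (not (bit s x))
      where
      swap : ∀ a e b → (a ∧ e) ∧ b ≡ (a ∧ b) ∧ e
      swap true  e b = ∧-comm e b
      swap false _ _ = refl

  G-chain : ∀ r s → r + s ≤ m → G s ≈P ((onePlusT ^P r) *P G (r + s))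
  G-chain zero    s _         j = sym (*P-identityˡ (G s) j)
  G-chain (suc r) s 1+r+s≤m j = begin
    coeff (G s) j
      ≡⟨ G-step s<m j ⟩
    coeff (onePlusT *P G (suc s)) j
      ≡⟨ *P-congʳ onePlusT {G (suc s)} {(onePlusT ^P r) *P G (r + suc s)}
                  (G-chain r (suc s) r+1+s≤m) j ⟩
    coeff (onePlusT *P ((onePlusT ^P r) *P G (r + suc s))) j
      ≡⟨ *P-assoc onePlusT (onePlusT ^P r) (G (r + suc s)) j ⟨
    coeff ((onePlusT ^P suc r) *P G (r + suc s)) j
      ≡⟨ cong (λ i → coeff ((onePlusT ^P suc r) *P G i) j) (ℕ.+-suc r s) ⟩
    coeff ((onePlusT ^P suc r) *P G (suc r + s)) j ∎
    where
    open ≡-Reasoning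
    s<m : s < m
    s<m = ℕ.≤-trans (s≤s (ℕ.m≤n+m s r)) 1+r+s≤m
    r+1+s≤m : r + suc s ≤ m
    r+1+s≤m = subst (_≤ m) (sym (ℕ.+-suc r s)) 1+r+s≤m

  onePlusT^m∣genPoly : (onePlusT ^P m) ∣P genPoly stat S
  onePlusT^m∣genPoly = G (m + 0) , λ j →
    trans (cong (λ L → coeff (genPoly stat L) j) (sym (filter-true S)))
          (G-chain m 0 (ℕ.≤-reflexive (ℕ.+-identityʳ m)) j)

lt-true : ∀ {x y} → x ℤ.< y → lt x y ≡ true
lt-true {x} {y} x<y = trans (isYes≗does (x ℤ.<? y)) (dec-true (x ℤ.<? y) x<y)

lt-false : ∀ {x y} → ¬ x ℤ.< y → lt x y ≡ false
lt-false {x} {y} x≮y = trans (isYes≗does (x ℤ.<? y)) (dec-false (x ℤ.<? y) x≮y)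

lt-flip : ∀ {x y} → x ≢ y → lt y x ≡ not (lt x y)
lt-flip {x} {y} x≢y with ℤ.<-cmp x y
... | tri< x<y _ _ rewrite lt-true x<y = lt-false (ℤ.<-asym x<y)
... | tri≈ _ x≡y _ = ⊥-elim (x≢y x≡y)
... | tri> x≮y _ y<x rewrite lt-false x≮y = lt-true y<x

lt-neg : ∀ x y → lt (- x) (- y) ≡ lt y x
lt-neg x y with y ℤ.<? x
... | yes y<x = lt-true (ℤ.neg-mono-< y<x)
... | no y≮x = lt-false (y≮x ∘ ℤ.neg-cancel-<)

<⇒<ᵇ≡true : ∀ {a b} → a < b → (a <ᵇ b) ≡ true
<⇒<ᵇ≡true {zero}  {suc b} _         = refl
<⇒<ᵇ≡true {suc a} {suc b} (s≤s a<b) = <⇒<ᵇ≡true a<b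

<⇒>ᵇ≡false : ∀ {a b} → a < b → (b <ᵇ a) ≡ false
<⇒>ᵇ≡false {zero}  {suc b} _         = refl
<⇒>ᵇ≡false {suc a} {suc b} (s≤s a<b) = <⇒>ᵇ≡false a<b

lt-+ : ∀ a b → lt (+ a) (+ b) ≡ (a <ᵇ b)
lt-+ a b = isYes≗does (+ a ℤ.<? + b)

lt-- : ∀ a b → lt -[1+ a ] -[1+ b ] ≡ (b <ᵇ a)
lt-- a b = isYes≗does (-[1+ a ] ℤ.<? -[1+ b ])

lt-negʳ-flips : ∀ x y → ∣ x ∣ < ∣ y ∣ → lt x (- y) ≡ not (lt x y)
lt-negʳ-flips (+ a)    (+ suc b)  p       rewrite lt-+ a (suc b) | <⇒<ᵇ≡true p = refl
lt-negʳ-flips (+ a)    -[1+ b ]   p       rewrite lt-+ a (suc b) | <⇒<ᵇ≡true p = refl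
lt-negʳ-flips -[1+ a ] (+ suc b)  (s≤s p) rewrite lt-- a b | <⇒>ᵇ≡false p = refl
lt-negʳ-flips -[1+ a ] -[1+ b ]   (s≤s p) rewrite lt-- a b | <⇒>ᵇ≡false p = refl

lt-negʳ-keeps : ∀ x y → ∣ y ∣ < ∣ x ∣ → lt x (- y) ≡ lt x y
lt-negʳ-keeps x        (+ zero)   _       = refl
lt-negʳ-keeps (+ a)    (+ suc b)  p       rewrite lt-+ a (suc b) | <⇒>ᵇ≡false p = refl
lt-negʳ-keeps (+ a)    -[1+ b ]   p       rewrite lt-+ a (suc b) | <⇒>ᵇ≡false p = refl
lt-negʳ-keeps -[1+ a ] (+ suc b)  (s≤s p) rewrite lt-- a b | <⇒<ᵇ≡true p = refl
lt-negʳ-keeps -[1+ a ] -[1+ b ]   (s≤s p) rewrite lt-- a b | <⇒<ᵇ≡true p = refl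

turn : ℤ → ℤ → ℤ → Bool
turn a b c = lt a b xor lt b c

turns : List ℤ → List Bool
turns (a ∷ b ∷ c ∷ r) = turn a b c ∷ turns (b ∷ c ∷ r)
turns _               = []

length-turns : ∀ w → length (turns w) ≡ length w ∸ 2
length-turns []              = refl
length-turns (a ∷ [])        = refl
length-turns (a ∷ b ∷ [])    = refl
length-turns (a ∷ b ∷ c ∷ r) = cong suc (length-turns (b ∷ c ∷ r))

countB-peak+valley : ∀ p q → countB (p ∧ not q) + countB (not p ∧ q) ≡ countB (p xor q)
countB-peak+valley true  true  = refl
countB-peak+valley true  false = refl
countB-peak+valley false true  = refl
countB-peak+valley false false = refl

pkL+valL≡#turns : ∀ {w} → Linked _≢_ w → pkL w + valL w ≡ count id (turns w)
pkL+valL≡#turns []       = refl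
pkL+valL≡#turns [-]      = refl
pkL+valL≡#turns (_ ∷ [-]) = refl
pkL+valL≡#turns {a ∷ b ∷ c ∷ r} (a≢b ∷ b≢c ∷ rest) = begin
  (countB (lt a b ∧ lt c b) + pkL (b ∷ c ∷ r)) + (countB (lt b a ∧ lt b c) + valL (b ∷ c ∷ r))
    ≡⟨ interchange (countB (lt a b ∧ lt c b)) _ _ _ ⟩
  (countB (lt a b ∧ lt c b) + countB (lt b a ∧ lt b c)) + (pkL (b ∷ c ∷ r) + valL (b ∷ c ∷ r))
    ≡⟨ cong₂ _+_ peak+valley (pkL+valL≡#turns (b≢c ∷ rest)) ⟩
  countB (turn a b c) + count id (turns (b ∷ c ∷ r)) ∎
  where
  open ≡-Reasoning
  peak+valley : countB (lt a b ∧ lt c b) + countB (lt b a ∧ lt b c) ≡ countB (turn a b c)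
  peak+valley rewrite lt-flip b≢c | lt-flip a≢b = countB-peak+valley (lt a b) (lt b c)

altrunsD≡1+#turns : ∀ π → Linked _≢_ (+ 0 ∷ π) → altrunsD π ≡ suc (count id (turns (+ 0 ∷ π)))
altrunsD≡1+#turns π linked = trans (cong (_+ 1) (pkL+valL≡#turns linked)) (ℕ.+-comm _ 1)

turn-neg : ∀ {a b c} → a ≢ b → b ≢ c → turn (- a) (- b) (- c) ≡ turn a b c
turn-neg {a} {b} {c} a≢b b≢c
  rewrite lt-neg a b | lt-neg b c | lt-flip a≢b | lt-flip b≢c =
  xor-annihilates-not (lt a b) (lt b c)

turns-neg : ∀ {w} → Linked _≢_ w → turns (map -_ w) ≡ turns w
turns-neg []                 = refl
turns-neg [-]                = refl
turns-neg (_ ∷ [-])          = refl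
turns-neg (a≢b ∷ b≢c ∷ rest) = cong₂ _∷_ (turn-neg a≢b b≢c) (turns-neg (b≢c ∷ rest))

negateFrom : ℕ → List ℤ → List ℤ
negateFrom zero    w       = map -_ w
negateFrom (suc c) []      = []
negateFrom (suc c) (x ∷ w) = x ∷ negateFrom c w

negateFrom-involutive : ∀ c w → negateFrom c (negateFrom c w) ≡ w
negateFrom-involutive zero    []      = refl
negateFrom-involutive zero    (x ∷ w) =
  cong₂ _∷_ (ℤ.neg-involutive x) (negateFrom-involutive zero w)
negateFrom-involutive (suc c) []      = refl
negateFrom-involutive (suc c) (x ∷ w) = cong (x ∷_) (negateFrom-involutive c w)

abs-negateFrom : ∀ c w → map ∣_∣ (negateFrom c w) ≡ map ∣_∣ w
abs-negateFrom zero    []      = refl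
abs-negateFrom zero    (x ∷ w) = cong₂ _∷_ (ℤ.∣-i∣≡∣i∣ x) (abs-negateFrom zero w)
abs-negateFrom (suc c) []      = refl
abs-negateFrom (suc c) (x ∷ w) = cong (∣ x ∣ ∷_) (abs-negateFrom c w)

record DistinctAbs (x y : ℤ) : Set where
  constructor distinctAbs
  field ∣≢∣ : ∣ x ∣ ≢ ∣ y ∣

DistinctAbs⇒≢ : ∀ {x y} → DistinctAbs x y → x ≢ y
DistinctAbs⇒≢ (distinctAbs ∣x∣≢∣y∣) = ∣x∣≢∣y∣ ∘ cong ∣_∣

toggleAt : ℕ → List Bool → List Bool
toggleAt _       []       = []
toggleAt zero    (b ∷ bs) = not b ∷ bs
toggleAt (suc i) (b ∷ bs) = b ∷ toggleAt i bs

bitAt : List Bool → ℕ → Bool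
bitAt []       _       = false
bitAt (b ∷ _)  zero    = b
bitAt (_ ∷ bs) (suc i) = bitAt bs i

count-toggleAt : ∀ i bs → i < length bs → bitAt bs i ≡ false →
  count id (toggleAt i bs) ≡ suc (count id bs)
count-toggleAt zero    (false ∷ bs) _         refl = refl
count-toggleAt (suc i) (b ∷ bs)     (s≤s i<n) off =
  trans (cong (_+_ (countB b)) (count-toggleAt i bs i<n off)) (ℕ.+-suc (countB b) (count id bs))

bitAt-toggleAt : ∀ i bs → i < length bs → bitAt (toggleAt i bs) i ≡ not (bitAt bs i)
bitAt-toggleAt zero    (b ∷ bs) _         = refl
bitAt-toggleAt (suc i) (b ∷ bs) (s≤s i<n) = bitAt-toggleAt i bs i<n

bitAt-toggleAt-≢ : ∀ i j bs → i ≢ j → bitAt (toggleAt i bs) j ≡ bitAt bs j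
bitAt-toggleAt-≢ i       j       []       _   = refl
bitAt-toggleAt-≢ zero    zero    (b ∷ bs) i≢j = ⊥-elim (i≢j refl)
bitAt-toggleAt-≢ zero    (suc j) (b ∷ bs) _   = refl
bitAt-toggleAt-≢ (suc i) zero    (b ∷ bs) _   = refl
bitAt-toggleAt-≢ (suc i) (suc j) (b ∷ bs) i≢j = bitAt-toggleAt-≢ i j bs (i≢j ∘ cong suc)

-- The index in turns (a ∷ w) of the turn toggled by negateFrom c w (see turns-negateFrom); the
-- clauses for lists too short to have that turn are junk.
togglePos : ℕ → List ℕ → ℕ
togglePos zero          _           = 0
togglePos (suc zero)    (a ∷ b ∷ _) = if a <ᵇ b then 0 else 1
togglePos (suc zero)    _           = 0
togglePos (suc (suc c)) []          = suc (togglePos (suc c) [])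
togglePos (suc (suc c)) (_ ∷ as)    = suc (togglePos (suc c) as)

togglePos-≤ : ∀ c as → togglePos c as ≤ c
togglePos-≤ zero          _           = z≤n
togglePos-≤ (suc zero)    (a ∷ b ∷ _) with a <ᵇ b
... | true  = z≤n
... | false = s≤s z≤n
togglePos-≤ (suc zero)    []          = z≤n
togglePos-≤ (suc zero)    (_ ∷ [])    = z≤n
togglePos-≤ (suc (suc c)) []          = s≤s (togglePos-≤ (suc c) [])
togglePos-≤ (suc (suc c)) (_ ∷ as)    = s≤s (togglePos-≤ (suc c) as)

togglePos-≥ : ∀ c as → c ∸ 1 ≤ togglePos c as
togglePos-≥ zero          _        = z≤n
togglePos-≥ (suc zero)    _        = z≤n
togglePos-≥ (suc (suc c)) []       = s≤s (togglePos-≥ (suc c) [])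
togglePos-≥ (suc (suc c)) (_ ∷ as) = s≤s (togglePos-≥ (suc c) as)

-- Negating w from position c ≥ 1 on toggles exactly one turn of a ∷ w: the one at whichever of
-- w[c-1], w[c] has the smaller absolute value.
turns-negateFrom : ∀ a c w → 1 ≤ c → 2 + c ≤ length w → Linked DistinctAbs w →
  turns (a ∷ negateFrom c w) ≡ toggleAt (togglePos c (map ∣_∣ w)) (turns (a ∷ w))
turns-negateFrom a (suc zero) (b ∷ y ∷ z ∷ r) _ _ (distinctAbs ∣b∣≢∣y∣ ∷ y≁z ∷ rest)
  with ℕ.<-cmp ∣ b ∣ ∣ y ∣
... | tri< ∣b∣<∣y∣ _ _ rewrite <⇒<ᵇ≡true ∣b∣<∣y∣ =
  cong₂ _∷_ first (cong₂ _∷_ second (turns-neg (Linked.map DistinctAbs⇒≢ (y≁z ∷ rest))))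
  where
  y≢z : y ≢ z
  y≢z = DistinctAbs⇒≢ y≁z
  first : lt a b xor lt b (- y) ≡ not (turn a b y)
  first = cong (lt a b xor_) (lt-negʳ-flips b y ∣b∣<∣y∣)
    ⟨ trans ⟩ sym (not-distribʳ-xor (lt a b) (lt b y))
  second : lt b (- y) xor lt (- y) (- z) ≡ turn b y z
  second = cong₂ _xor_ (lt-negʳ-flips b y ∣b∣<∣y∣) (lt-neg y z ⟨ trans ⟩ lt-flip y≢z)
    ⟨ trans ⟩ xor-annihilates-not (lt b y) (lt y z)
... | tri≈ _ ∣b∣≡∣y∣ _ = ⊥-elim (∣b∣≢∣y∣ ∣b∣≡∣y∣)
... | tri> _ _ ∣y∣<∣b∣ rewrite <⇒>ᵇ≡false ∣y∣<∣b∣ =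
  cong₂ _∷_ first (cong₂ _∷_ second (turns-neg (Linked.map DistinctAbs⇒≢ (y≁z ∷ rest))))
  where
  y≢z : y ≢ z
  y≢z = DistinctAbs⇒≢ y≁z
  first : lt a b xor lt b (- y) ≡ turn a b y
  first = cong (lt a b xor_) (lt-negʳ-keeps b y ∣y∣<∣b∣)
  second : lt b (- y) xor lt (- y) (- z) ≡ not (turn b y z)
  second = cong₂ _xor_ (lt-negʳ-keeps b y ∣y∣<∣b∣) (lt-neg y z ⟨ trans ⟩ lt-flip y≢z)
    ⟨ trans ⟩ sym (not-distribʳ-xor (lt b y) (lt y z))
turns-negateFrom a (suc zero) (b ∷ []) _ (s≤s ()) _
turns-negateFrom a (suc zero) (b ∷ y ∷ []) _ (s≤s (s≤s ())) _
turns-negateFrom a (suc (suc c)) (b ∷ y ∷ w) _ (s≤s 2+c≤∣w∣) (_ ∷ linked) =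
  cong (turn a b y ∷_) (turns-negateFrom b (suc c) (y ∷ w) (s≤s z≤n) 2+c≤∣w∣ linked)

neg-map-neg : ∀ {w} → All (DistinctAbs (+ 0)) w → neg (map -_ w) + neg w ≡ length w
neg-map-neg []                      = refl
neg-map-neg {x ∷ w} (0≁x ∷ nonzero)
  rewrite trans (lt-neg x (+ 0)) (lt-flip (DistinctAbs⇒≢ 0≁x ∘ sym)) with lt x (+ 0)
... | true  = trans (ℕ.+-suc (neg (map -_ w)) (neg w)) (cong suc (neg-map-neg nonzero))
... | false = cong suc (neg-map-neg nonzero)

even-neg-negateFrom : ∀ c w → All (DistinctAbs (+ 0)) w → even (length w ∸ c) ≡ true →
  even (neg (negateFrom c w)) ≡ even (neg w)
even-neg-negateFrom zero    w       nonzero even-suffix =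
  even-+-true (neg (map -_ w)) (neg w) (trans (cong even (neg-map-neg nonzero)) even-suffix)
even-neg-negateFrom (suc c) []      _             _           = refl
even-neg-negateFrom (suc c) (x ∷ w) (_ ∷ nonzero) even-suffix =
  even-cong-+ sign sign (neg (negateFrom c w)) (neg w)
    refl (even-neg-negateFrom c w nonzero even-suffix)
  where
  sign : ℕ
  sign = countB (lt x (+ 0))

inversions : List ℕ → ℕ
inversions []       = 0
inversions (a ∷ as) = count (_<ᵇ a) as + inversions as

even-inversionPair : ∀ {x y} → DistinctAbs x y →
  even (countB (lt y x) + countB (lt y (- x))) ≡ even (countB (∣ y ∣ <ᵇ ∣ x ∣))
even-inversionPair {x} {y} x≁y with ℕ.<-cmp ∣ y ∣ ∣ x ∣
... | tri< ∣y∣<∣x∣ _ _ rewrite lt-negʳ-flips y x ∣y∣<∣x∣ | <⇒<ᵇ≡true ∣y∣<∣x∣ with lt y x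
...   | true  = refl
...   | false = refl
even-inversionPair {x} {y} x≁y | tri≈ _ ∣y∣≡∣x∣ _ = ⊥-elim (DistinctAbs.∣≢∣ x≁y (sym ∣y∣≡∣x∣))
even-inversionPair {x} {y} x≁y | tri> _ _ ∣x∣<∣y∣
  rewrite lt-negʳ-keeps y x ∣x∣<∣y∣ | <⇒>ᵇ≡false ∣x∣<∣y∣ = even-double (countB (lt y x))

even-invFrom : ∀ {x ys} → All (DistinctAbs x) ys →
  even (invFrom x ys) ≡ even (count (_<ᵇ ∣ x ∣) (map ∣_∣ ys))
even-invFrom []            = refl
even-invFrom {x} {y ∷ ys} (x≁y ∷ x≁ys) =
  even-cong-+ (countB (lt y x) + countB (lt y (- x))) (countB (∣ y ∣ <ᵇ ∣ x ∣))
    (invFrom x ys) (count (_<ᵇ ∣ x ∣) (map ∣_∣ ys))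
    (even-inversionPair x≁y) (even-invFrom x≁ys)

even-invD : ∀ {w} → AllPairs DistinctAbs w → even (invD w) ≡ even (inversions (map ∣_∣ w))
even-invD []                = refl
even-invD {x ∷ w} (x≁w ∷ distinct) =
  even-cong-+ (invFrom x w) (count (_<ᵇ ∣ x ∣) (map ∣_∣ w)) (invD w) (inversions (map ∣_∣ w))
    (even-invFrom x≁w) (even-invD distinct)

∈-words⁻ : ∀ A k {π} → π ∈ words A k → length π ≡ k × All (_∈ A) π
∈-words⁻ A zero    (here refl) = refl , []
∈-words⁻ A (suc k) π∈words with find (∈-concatMap⁻ (λ w → map (_∷ w) A) {xs = words A k} π∈words)
... | w , w∈words , π∈map with ∈-map⁻ (_∷ w) π∈map
... | a , a∈A , refl with ∈-words⁻ A k w∈words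
... | length≡k , w⊆A = cong suc length≡k , a∈A ∷ w⊆A

∈-words⁺ : ∀ A {π} → All (_∈ A) π → π ∈ words A (length π)
∈-words⁺ A []                  = here refl
∈-words⁺ A {a ∷ w} (a∈A ∷ w⊆A) =
  ∈-concatMap⁺ (λ w → map (_∷ w) A) (lose (∈-words⁺ A w⊆A) (∈-map⁺ (_∷ w) a∈A))

letters-neg : ∀ {n x} → x ∈ letters n → - x ∈ letters n
letters-neg {n} x∈ with ∈-++⁻ (map (λ k → + suc k) (upTo n)) x∈
... | inj₁ x∈pos with ∈-map⁻ (λ k → + suc k) x∈pos
...   | k , k∈ , refl = ∈-++⁺ʳ (map (λ k → + suc k) (upTo n)) (∈-map⁺ -[1+_] k∈)
letters-neg {n} x∈ | inj₂ x∈neg with ∈-map⁻ -[1+_] x∈neg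
...   | k , k∈ , refl = ∈-++⁺ˡ (∈-map⁺ (λ k → + suc k) k∈)

letters-nonzero : ∀ {n x} → x ∈ letters n → DistinctAbs (+ 0) x
letters-nonzero {n} x∈ with ∈-++⁻ (map (λ k → + suc k) (upTo n)) x∈
... | inj₁ x∈pos with ∈-map⁻ (λ k → + suc k) x∈pos
...   | k , _ , refl = distinctAbs λ ()
letters-nonzero {n} x∈ | inj₂ x∈neg with ∈-map⁻ -[1+_] x∈neg
...   | k , _ , refl = distinctAbs λ ()

letters-unique : ∀ n → Unique (letters n)
letters-unique n = Unique.++⁺ (Unique.map⁺ +suc-injective (Unique.upTo⁺ n))
                              (Unique.map⁺ -[1+]-injective (Unique.upTo⁺ n)) disjoint
  where
  +suc-injective : ∀ {a b} → + suc a ≡ + suc b → a ≡ b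
  +suc-injective refl = refl
  -[1+]-injective : ∀ {a b} → -[1+ a ] ≡ -[1+ b ] → a ≡ b
  -[1+]-injective refl = refl
  disjoint : Disjoint (map (λ k → + suc k) (upTo n)) (map -[1+_] (upTo n))
  disjoint (x∈pos , x∈neg) with ∈-map⁻ _ x∈pos | ∈-map⁻ _ x∈neg
  ... | _ , _ , refl | _ , _ , ()

words-unique : ∀ A → Unique A → ∀ k → Unique (words A k)
words-unique A uniqueA zero    = [] ∷ []
words-unique A uniqueA (suc k) =
  Unique.concat⁺ (All.map⁺ (All.universal (λ _ → Unique.map⁺ (proj₁ ∘ ∷-injective) uniqueA) _))
                 (AllPairs.map⁺ (AllPairs.map disjoint (words-unique A uniqueA k)))
  where
  disjoint : ∀ {w w′} → w ≢ w′ → Disjoint (map (_∷ w) A) (map (_∷ w′) A)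
  disjoint w≢w′ (x∈ , x∈′) with ∈-map⁻ _ x∈ | ∈-map⁻ _ x∈′
  ... | _ , _ , refl | _ , _ , x≡ = w≢w′ (proj₂ (∷-injective x≡))

B-unique : ∀ n → Unique (B n)
B-unique n =
  Unique.filter⁺ (λ w → absDistinct w ≟B true) (words-unique (letters n) (letters-unique n) n)

absMem-false : ∀ {x ys} → absMem x ys ≡ false → All (DistinctAbs x) ys
absMem-false {x} {[]}     _         = []
absMem-false {x} {y ∷ ys} not-found with ∣ x ∣ ℕ.≟ ∣ y ∣
... | no ∣x∣≢∣y∣ = distinctAbs ∣x∣≢∣y∣ ∷ absMem-false not-found

absDistinct⇒AllPairs : ∀ {w} → absDistinct w ≡ true → AllPairs DistinctAbs w
absDistinct⇒AllPairs {[]}    _        = []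
absDistinct⇒AllPairs {x ∷ w} distinct with absMem x w in x∉w
... | false = absMem-false x∉w ∷ absDistinct⇒AllPairs distinct

absMem-abs : ∀ {x x′ ys ys′} → ∣ x ∣ ≡ ∣ x′ ∣ → map ∣_∣ ys ≡ map ∣_∣ ys′ →
  absMem x ys ≡ absMem x′ ys′
absMem-abs {ys = []}     {[]}       _     _     = refl
absMem-abs {ys = y ∷ ys} {y′ ∷ ys′} ∣x∣≡ ∣ys∣≡ with ∷-injective ∣ys∣≡
... | ∣y∣≡ , ∣ys∣≡′ = cong₂ _∨_ (cong₂ (λ a b → ⌊ a ℕ.≟ b ⌋) ∣x∣≡ ∣y∣≡) (absMem-abs ∣x∣≡ ∣ys∣≡′)

absDistinct-abs : ∀ {w w′} → map ∣_∣ w ≡ map ∣_∣ w′ → absDistinct w ≡ absDistinct w′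
absDistinct-abs {[]}    {[]}      _     = refl
absDistinct-abs {x ∷ w} {x′ ∷ w′} ∣w∣≡ with ∷-injective ∣w∣≡
... | ∣x∣≡ , ∣w∣≡′ = cong₂ (λ a b → not a ∧ b) (absMem-abs ∣x∣≡ ∣w∣≡′) (absDistinct-abs ∣w∣≡′)

∈-B⁻ : ∀ n {π} → π ∈ B n → (length π ≡ n × All (_∈ letters n) π) × absDistinct π ≡ true
∈-B⁻ n π∈B with ∈-filter⁻ (λ w → absDistinct w ≟B true) {xs = words (letters n) n} π∈B
... | π∈words , distinct = ∈-words⁻ (letters n) n π∈words , distinct

∈-B⁺ : ∀ n {π} → length π ≡ n → All (_∈ letters n) π → absDistinct π ≡ true → π ∈ B n
∈-B⁺ n refl π⊆letters distinct =
  ∈-filter⁺ (λ w → absDistinct w ≟B true) (∈-words⁺ (letters n) π⊆letters) distinct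

B-length : ∀ n {π} → π ∈ B n → length π ≡ n
B-length n π∈B = proj₁ (proj₁ (∈-B⁻ n π∈B))

-- Prefixing 0 records that no entry is 0.
B-distinctAbs : ∀ n {π} → π ∈ B n → AllPairs DistinctAbs (+ 0 ∷ π)
B-distinctAbs n π∈B with ∈-B⁻ n π∈B
... | (_ , π⊆letters) , distinct =
  All.map (letters-nonzero {n}) π⊆letters ∷ absDistinct⇒AllPairs distinct

negateFrom-All : ∀ {P : ℤ → Set} → (∀ {x} → P x → P (- x)) →
  ∀ c {w} → All P w → All P (negateFrom c w)
negateFrom-All P-neg zero    w⊆P         = All.map⁺ (All.map P-neg w⊆P)
negateFrom-All P-neg (suc c) []          = []
negateFrom-All P-neg (suc c) (px ∷ w⊆P) = px ∷ negateFrom-All P-neg c w⊆P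

length-negateFrom : ∀ c w → length (negateFrom c w) ≡ length w
length-negateFrom c w =
  trans (sym (length-map ∣_∣ (negateFrom c w)))
        (trans (cong length (abs-negateFrom c w)) (length-map ∣_∣ w))

negateFrom-∈B : ∀ n {π} c → π ∈ B n → negateFrom c π ∈ B n
negateFrom-∈B n {π} c π∈B with ∈-B⁻ n π∈B
... | (length≡n , π⊆letters) , distinct =
  ∈-B⁺ n (trans (length-negateFrom c π) length≡n) (negateFrom-All (letters-neg {n}) c π⊆letters)
       (trans (absDistinct-abs (abs-negateFrom c π)) distinct)

∸-gap : ∀ {n d d′} → d + 2 ≤ d′ → d′ ≤ n → 2 + (n ∸ d′) ≤ n ∸ d
∸-gap {n} {d} {d′} d+2≤d′ d′≤n = ℕ.m+n≤o⇒m≤o∸n (2 + (n ∸ d′)) (begin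
  2 + (n ∸ d′) + d     ≡⟨ rearrange (n ∸ d′) d ⟩
  (n ∸ d′) + (d + 2)   ≤⟨ ℕ.+-monoʳ-≤ (n ∸ d′) d+2≤d′ ⟩
  (n ∸ d′) + d′        ≡⟨ ℕ.m∸n+n≡m d′≤n ⟩
  n                    ∎)
  where
  open ℕ.≤-Reasoning
  rearrange : ∀ x d → 2 + x + d ≡ x + (d + 2)
  rearrange = solve-∀-ℕ

togglePos-< : ∀ {c c′} as → 2 + c ≤ c′ → togglePos c as < c′ ∸ 1
togglePos-< {c} as 2+c≤c′ = ℕ.≤-trans (s≤s (togglePos-≤ c as)) (ℕ.∸-monoˡ-≤ 1 2+c≤c′)

double<n : ∀ n {k} → k < (n ∸ 1) / 2 → suc k + suc k < n
double<n zero     k<0   = ⊥-elim (ℕ.n≮0 k<0)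
double<n (suc n′) {k} k<m = s≤s (begin
  suc k + suc k     ≤⟨ ℕ.+-mono-≤ k<m k<m ⟩
  n′ / 2 + n′ / 2   ≡⟨ double (n′ / 2) ⟩
  n′ / 2 * 2        ≤⟨ m/n*n≤m n′ 2 ⟩
  n′                ∎)
  where
  open ℕ.≤-Reasoning
  double : ∀ h → h + h ≡ h * 2
  double = solve-∀-ℕ

module SuffixFlips (n : ℕ) where

  m : ℕ
  m = (n ∸ 1) / 2

  start : ℕ → ℕ
  start k = n ∸ (suc k + suc k)

  flip : ℕ → List ℤ → List ℤ
  flip k = negateFrom (start k)

  pos : ℕ → List ℤ → ℕ
  pos k π = togglePos (start k) (map ∣_∣ π)

  bit : ℕ → List ℤ → Bool
  bit k π = bitAt (turns (+ 0 ∷ π)) (pos k π)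

  start-pos : ∀ {k} → k < m → 1 ≤ start k
  start-pos k<m = ℕ.m<n⇒0<n∸m (double<n n k<m)

  start-room : ∀ {k} → k < m → 2 + start k ≤ n
  start-room k<m = ∸-gap {d = 0} (ℕ.+-mono-≤ (s≤s z≤n) (s≤s z≤n)) (ℕ.<⇒≤ (double<n n k<m))

  start-gap : ∀ {j k} → j < k → k < m → 2 + start k ≤ start j
  start-gap {j} {k} j<k k<m = ∸-gap {d = suc j + suc j} gap (ℕ.<⇒≤ (double<n n k<m))
    where
    shift : ∀ j → suc j + suc j + 2 ≡ suc (suc j) + suc (suc j)
    shift = solve-∀-ℕ
    gap : suc j + suc j + 2 ≤ suc k + suc k
    gap = subst (_≤ suc k + suc k) (sym (shift j)) (ℕ.+-mono-≤ (s≤s j<k) (s≤s j<k))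

  B-linked : ∀ {π} → π ∈ B n → Linked _≢_ (+ 0 ∷ π)
  B-linked π∈B = Linked.map DistinctAbs⇒≢ (AllPairs⇒Linked (B-distinctAbs n π∈B))

  flip-∈B : ∀ {k π} → π ∈ B n → flip k π ∈ B n
  flip-∈B {k} = negateFrom-∈B n (start k)

  turns-flip : ∀ {k π} → k < m → π ∈ B n →
    turns (+ 0 ∷ flip k π) ≡ toggleAt (pos k π) (turns (+ 0 ∷ π))
  turns-flip {k} {π} k<m π∈B with B-distinctAbs n π∈B
  ... | _ ∷ distinct = turns-negateFrom (+ 0) (start k) π (start-pos k<m)
    (subst (2 + start k ≤_) (sym (B-length n π∈B)) (start-room k<m)) (AllPairs⇒Linked distinct)

  pos-flip : ∀ j k π → pos j (flip k π) ≡ pos j π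
  pos-flip j k π = cong (togglePos (start j)) (abs-negateFrom (start k) π)

  pos<length : ∀ {k π} → k < m → π ∈ B n → pos k π < length (turns (+ 0 ∷ π))
  pos<length {k} {π} k<m π∈B rewrite length-turns (+ 0 ∷ π) | B-length n π∈B =
    togglePos-< (map ∣_∣ π) (start-room k<m)

  bit-flip : ∀ {k π} → k < m → π ∈ B n → bit k (flip k π) ≡ not (bit k π)
  bit-flip {k} {π} k<m π∈B = trans (cong₂ bitAt (turns-flip k<m π∈B) (pos-flip k k π))
    (bitAt-toggleAt (pos k π) (turns (+ 0 ∷ π)) (pos<length k<m π∈B))

  bit-flip-< : ∀ {j k π} → j < k → k < m → π ∈ B n → bit j (flip k π) ≡ bit j π
  bit-flip-< {j} {k} {π} j<k k<m π∈B = trans (cong₂ bitAt (turns-flip k<m π∈B) (pos-flip j k π))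
    (bitAt-toggleAt-≢ (pos k π) (pos j π) (turns (+ 0 ∷ π)) (ℕ.<⇒≢ pos-k<pos-j))
    where
    pos-k<pos-j : pos k π < pos j π
    pos-k<pos-j =
      ℕ.≤-trans (togglePos-< (map ∣_∣ π) (start-gap j<k k<m)) (togglePos-≥ (start j) (map ∣_∣ π))

  altrunsD-flip : ∀ {k π} → k < m → π ∈ B n → bit k π ≡ false →
    altrunsD (flip k π) ≡ suc (altrunsD π)
  altrunsD-flip {k} {π} k<m π∈B off = begin
    altrunsD (flip k π)
      ≡⟨ altrunsD≡1+#turns (flip k π) (B-linked (flip-∈B π∈B)) ⟩
    suc (count id (turns (+ 0 ∷ flip k π)))
      ≡⟨ cong (suc ∘ count id) (turns-flip k<m π∈B) ⟩
    suc (count id (toggleAt (pos k π) (turns (+ 0 ∷ π))))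
      ≡⟨ cong suc (count-toggleAt (pos k π) (turns (+ 0 ∷ π)) (pos<length k<m π∈B) off) ⟩
    suc (suc (count id (turns (+ 0 ∷ π))))
      ≡⟨ cong suc (altrunsD≡1+#turns π (B-linked π∈B)) ⟨
    suc (altrunsD π) ∎
    where open ≡-Reasoning

  inD-flip : ∀ {k π} → k < m → π ∈ B n → inD (flip k π) ≡ inD π
  inD-flip {k} {π} k<m π∈B with B-distinctAbs n π∈B
  ... | nonzero ∷ _ = begin
    isEven (neg (flip k π)) ≡⟨ isEven≡even (neg (flip k π)) ⟩
    even (neg (flip k π))   ≡⟨ even-neg-negateFrom (start k) π nonzero even-suffix ⟩
    even (neg π)            ≡⟨ isEven≡even (neg π) ⟨
    isEven (neg π)          ∎
    where
    open ≡-Reasoning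
    even-suffix : even (length π ∸ start k) ≡ true
    even-suffix rewrite B-length n π∈B | ℕ.m∸[m∸n]≡n (ℕ.<⇒≤ (double<n n k<m)) = even-double (suc k)

  invD-flip : ∀ {k π} → π ∈ B n → isEven (invD (flip k π)) ≡ isEven (invD π)
  invD-flip {k} {π} π∈B with B-distinctAbs n (flip-∈B {k} π∈B) | B-distinctAbs n π∈B
  ... | _ ∷ distinct′ | _ ∷ distinct = begin
    isEven (invD (flip k π))               ≡⟨ isEven≡even (invD (flip k π)) ⟩
    even (invD (flip k π))                 ≡⟨ even-invD distinct′ ⟩
    even (inversions (map ∣_∣ (flip k π))) ≡⟨ cong (even ∘ inversions) (abs-negateFrom (start k) π) ⟩
    even (inversions (map ∣_∣ π))          ≡⟨ even-invD distinct ⟨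
    even (invD π)                          ≡⟨ isEven≡even (invD π) ⟨
    isEven (invD π)                        ∎
    where open ≡-Reasoning

-- Each of the six sets selects π ∈ 𝔅ₙ by a Boolean function F of (π ∈ 𝔇ₙ, inv_D(π) even).
R-divisible : ∀ n (F : Bool → Bool → Bool) →
  (onePlusT ^P ((n ∸ 1) / 2)) ∣P genAlt (sel (λ π → F (inD π) (isEven (invD π))) n)
R-divisible n F =
  TogglingInvolutions.onePlusT^m∣genPoly S S-unique altrunsD m bit flip
    (λ {k} _ π → negateFrom-involutive (start k) π) closed
    (λ k<m π∈S → bit-flip k<m (∈S⇒∈B π∈S))
    (λ j<k k<m π∈S → bit-flip-< j<k k<m (∈S⇒∈B π∈S))
    (λ k<m π∈S → altrunsD-flip k<m (∈S⇒∈B π∈S))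
  where
  open SuffixFlips n
  P : List ℤ → Bool
  P π = F (inD π) (isEven (invD π))
  S : List (List ℤ)
  S = sel P n
  S-unique : Unique S
  S-unique = Unique.filter⁺ (λ π → P π ≟B true) (B-unique n)
  ∈S⇒∈B : ∀ {π} → π ∈ S → π ∈ B n
  ∈S⇒∈B π∈S = proj₁ (∈-filter⁻ (λ π → P π ≟B true) {xs = B n} π∈S)
  closed : ∀ {k π} → k < m → π ∈ S → flip k π ∈ S
  closed {k} k<m π∈S with ∈-filter⁻ (λ π → P π ≟B true) {xs = B n} π∈S
  ... | π∈B , Pπ = ∈-filter⁺ (λ π → P π ≟B true) (flip-∈B π∈B)
    (trans (cong₂ F (inD-flip k<m π∈B) (invD-flip π∈B)) Pπ)

theorem54 : (n : ℕ) → 1 ≤ n →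
    let m = (n ∸ 1) / 2 in
    ((onePlusT ^P m) ∣P R-D n) × ((onePlusT ^P m) ∣P R-BD n) ×
    ((onePlusT ^P m) ∣P R-D+ n) × ((onePlusT ^P m) ∣P R-D- n) ×
    ((onePlusT ^P m) ∣P R-BD+ n) × ((onePlusT ^P m) ∣P R-BD- n)
theorem54 n _ =
  R-divisible n (λ d _ → d) ,
  R-divisible n (λ d _ → not d) ,
  R-divisible n (λ d e → d ∧ e) ,
  R-divisible n (λ d e → d ∧ not e) ,
  R-divisible n (λ d e → not d ∧ e) ,
  R-divisible n (λ d e → not d ∧ not e)
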